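{- Let $a_1,\dots,a_n$ and $Y$ be indeterminates (or elements of a field for which all expressions below are defined), let $\vec{w}$ denote the word $a_1,\dots,a_n$, $-\vec{w}$ the word $-a_1,\dots,-a_n$, $\overset{\leftarrow}{w}$ the word $a_n,\dots,a_1$ and $-\overset{\leftarrow}{w}$ the word $-a_n,\dots,-a_1$. Let $A_i/B_i$ denote the $i$-th convergent of the continued fraction $[1;a_1,a_2,\dots,a_n]$ (so $A_0=B_0=1$ and $A_{ -1}=1,B_{ -1}=0$, with the standard recurrences $A_i=a_iA_{i-1}+A_{i-2}$, $B_i=a_iB_{i-1}+B_{i-2}$). Then \[ [1;\vec{w},Y,-\vec{w}] = \frac{A_{n}}{B_{n}}\left(1+\frac{(-1)^n}{A_{n}(B_{n}(Y+1)-A_{n}+B_{n-1})}\right), \] \[ [1;\vec{w},Y,-\overset{\leftarrow}{w},-1] = \frac{A_{n}}{B_{n}}\left(1+\frac{1}{(-1)^nYA_{n}B_{n}-1} \right), \] \[ [1;\vec{w},Y,\overset{\leftarrow}{w},1] = \frac{A_{n}}{B_{n}}\left(1+\frac{1}{(-1)^{n}B_{n}(Y A_{n}+2A_{n-1})-1} \right), \] \[ [1;\vec{w},Y,\vec{w}] = \frac{A_{n}}{B_{n}}\left(1+\frac{(-1)^n}{A_{n}(B_{n}(Y-1)+A_{n}+B_{n-1})}\right). \]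
   Context: $[b_0;b_1,\dots,b_m]$ denotes the finite continued fraction $b_0+\cfrac{1}{b_1+\cfrac{1}{\ddots+\cfrac{1}{b_m}}}$. -}

module Defs where

open import Level using (Level; suc; _⊔_)
open import Algebra.Bundles using (CommutativeRing)
open import Data.List using (List; []; _∷_; _++_; map; reverse; foldl)
open import Data.Nat using (ℕ)
open import Data.Product using (_×_; _,_; proj₁; proj₂)
open import Relation.Nullary using (¬_)

record Field (c ℓ : Level) : Set (suc (c ⊔ ℓ)) where
  field
    commutativeRing : CommutativeRing c ℓ
  open CommutativeRing commutativeRing public
  field
    0≉1     : ¬ (0# ≈ 1#)
    inv     : (x : Carrier) → ¬ (x ≈ 0#) → Carrier
    inv-law : (x : Carrier) (p : ¬ (x ≈ 0#)) → x * inv x p ≈ 1#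

module FieldDefs {c ℓ : Level} (F : Field c ℓ) where
  open Field F

  sgn : ℕ → Carrier
  sgn ℕ.zero    = 1#
  sgn (ℕ.suc n) = - (sgn n)

  -- CF (b₀ ∷ b₁ ∷ … ∷ bₘ) v  :  the finite continued fraction [b₀; b₁, …, bₘ]
  -- is defined (every tail by which we divide is nonzero) and equals v.
  data CF : List Carrier → Carrier → Set (c ⊔ ℓ) where
    cf-last : (b : Carrier) → CF (b ∷ []) b
    cf-cons : (b : Carrier) (bs : List Carrier) (t : Carrier) →
              CF bs t → (p : ¬ (t ≈ 0#)) → CF (b ∷ bs) (b + inv t p)

  -- Convergents of [1; a₁, …, aₙ] via the standard recurrences
  --   A_i = a_i A_{i-1} + A_{i-2},  B_i = a_i B_{i-1} + B_{i-2},
  -- with A_{-1} = 1, B_{-1} = 0, A_0 = B_0 = 1.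
  -- step maps (A_{i-1}, A_{i-2}) to (A_i, A_{i-1}).
  step : Carrier × Carrier → Carrier → Carrier × Carrier
  step (x , y) a = (a * x + y , x)

  Apair : List Carrier → Carrier × Carrier
  Apair w = foldl step (1# , 1#) w

  Bpair : List Carrier → Carrier × Carrier
  Bpair w = foldl step (1# , 0#) w

  Aₙ Aₙ₋₁ Bₙ Bₙ₋₁ : List Carrier → Carrier
  Aₙ   w = proj₁ (Apair w)
  Aₙ₋₁ w = proj₂ (Apair w)
  Bₙ   w = proj₁ (Bpair w)
  Bₙ₋₁ w = proj₂ (Bpair w)

  neg : List Carrier → List Carrier
  neg = map (λ x → - x)

-- Encode the continued fraction [b₀; b₁, …, bₘ] by the product M of the
-- matrices ⟨ bᵢ ⟩ = (bᵢ 1; 1 0): its value is m₁₁ / m₂₁, and M(1 w) has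
-- rows (Aₙ Aₙ₋₁) and (Bₙ Bₙ₋₁).  The matrices of the four tails −w,
-- −w̃ (−1), w̃ 1 and w are all expressed through M(w) (negating a word
-- conjugates its matrix by diag(1, −1) up to the sign (−1)ⁿ, reversing it
-- transposes), so each of the four formulas becomes a polynomial identity
-- in Aₙ, Aₙ₋₁, Bₙ, Bₙ₋₁, Y and s = (−1)ⁿ that holds modulo the relation
-- det M(w) = s = ±1.

module Submission where

open import Defs
open import Level using (Level; 0ℓ)
open import Algebra.Bundles using (CommutativeRing; RawRing)
open import Data.List using (List; []; _∷_; _++_; length; reverse; foldl; [_])
open import Data.List.Properties using (unfold-reverse; length-reverse)
open import Data.Maybe using (Maybe; just; nothing)
open import Data.Nat as ℕ using (ℕ; zero; suc)
open import Data.Product using (_×_; _,_; proj₁; proj₂)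
import Data.Product.Properties as Product
open import Relation.Nullary using (¬_; yes; no)
import Relation.Binary.PropositionalEquality as ≡

-- The standard ring solvers need either decidable equality in the ring or
-- a coefficient ring mapping into it; integers, as pairs of naturals, map
-- into every commutative ring.
module IntegerCoefficientSolver {c ℓ : Level} (R : CommutativeRing c ℓ) where
  open CommutativeRing R
  open import Algebra.Properties.Ring ring using (-0#≈0#; -‿involutive; -‿distribˡ-*; -‿distribʳ-*)
  open import Algebra.Properties.AbelianGroup +-abelianGroup using (⁻¹-∙-comm)
  open import Algebra.Properties.CommutativeSemigroup +-commutativeSemigroup using (interchange)
  open import Algebra.Properties.Semiring.Mult.TCOptimised semiring
    using (×-homo-+; ×1-homo-*) renaming (_×_ to _·_)
  open import Algebra.Solver.Ring.AlmostCommutativeRing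
    using (fromCommutativeRing; _-Raw-AlmostCommutative⟶_)
  open import Relation.Binary.Reasoning.Setoid setoid

  ℤ : Set
  ℤ = ℕ × ℕ

  _⊕_ _⊗_ : ℤ → ℤ → ℤ
  (a , b) ⊕ (x , y) = (a ℕ.+ x , b ℕ.+ y)
  (a , b) ⊗ (x , y) = (a ℕ.* x ℕ.+ b ℕ.* y , a ℕ.* y ℕ.+ b ℕ.* x)

  ⊖_ : ℤ → ℤ
  ⊖ (a , b) = (b , a)

  ℤ-rawRing : RawRing 0ℓ 0ℓ
  ℤ-rawRing = record
    { Carrier = ℤ ; _≈_ = ≡._≡_ ; _+_ = _⊕_ ; _*_ = _⊗_ ; -_ = ⊖_ ; 0# = (0 , 0) ; 1# = (1 , 0) }

  -- Common successors are stripped, so pairs denoting the same integer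
  -- evaluate to the same term: this is what lets  solve … refl  succeed.
  ⟦_⟧ : ℤ → Carrier
  ⟦ (a , zero) ⟧ = a · 1#
  ⟦ (zero , suc b) ⟧ = - (suc b · 1#)
  ⟦ (suc a , suc b) ⟧ = ⟦ (a , b) ⟧

  ⟦⟧-difference : ∀ a b → ⟦ (a , b) ⟧ ≈ a · 1# - b · 1#
  ⟦⟧-difference a zero = sym (trans (+-congˡ -0#≈0#) (+-identityʳ _))
  ⟦⟧-difference zero (suc b) = sym (+-identityˡ _)
  ⟦⟧-difference (suc a) (suc b) = begin
    ⟦ (a , b) ⟧                           ≈⟨ ⟦⟧-difference a b ⟩
    a · 1# - b · 1#                       ≈⟨ +-identityˡ _ ⟨
    0# + (a · 1# - b · 1#)                ≈⟨ +-congʳ (-‿inverseʳ 1#) ⟨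
    (1# - 1#) + (a · 1# - b · 1#)         ≈⟨ interchange _ _ _ _ ⟩
    (1# + a · 1#) + (- 1# + - (b · 1#))
      ≈⟨ +-cong (×-homo-+ 1# 1 a) (trans (-‿cong (×-homo-+ 1# 1 b)) (sym (⁻¹-∙-comm _ _))) ⟨
    suc a · 1# - suc b · 1#               ∎

  ⊕-homo : ∀ p q → ⟦ p ⊕ q ⟧ ≈ ⟦ p ⟧ + ⟦ q ⟧
  ⊕-homo (a , b) (x , y) = begin
    ⟦ (a ℕ.+ x , b ℕ.+ y) ⟧                         ≈⟨ ⟦⟧-difference (a ℕ.+ x) (b ℕ.+ y) ⟩
    (a ℕ.+ x) · 1# - (b ℕ.+ y) · 1#
      ≈⟨ +-cong (×-homo-+ 1# a x) (trans (-‿cong (×-homo-+ 1# b y)) (sym (⁻¹-∙-comm _ _))) ⟩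
    (a · 1# + x · 1#) + (- (b · 1#) + - (y · 1#))   ≈⟨ interchange _ _ _ _ ⟩
    (a · 1# - b · 1#) + (x · 1# - y · 1#)           ≈⟨ +-cong (⟦⟧-difference a b) (⟦⟧-difference x y) ⟨
    ⟦ (a , b) ⟧ + ⟦ (x , y) ⟧                       ∎

  ⊗-homo : ∀ p q → ⟦ p ⊗ q ⟧ ≈ ⟦ p ⟧ * ⟦ q ⟧
  ⊗-homo (a , b) (x , y) = begin
    ⟦ (a ℕ.* x ℕ.+ b ℕ.* y , a ℕ.* y ℕ.+ b ℕ.* x) ⟧
      ≈⟨ ⟦⟧-difference (a ℕ.* x ℕ.+ b ℕ.* y) (a ℕ.* y ℕ.+ b ℕ.* x) ⟩
    (a ℕ.* x ℕ.+ b ℕ.* y) · 1# - (a ℕ.* y ℕ.+ b ℕ.* x) · 1#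
      ≈⟨ +-cong (·-homo-sum a x b y) (-‿cong (·-homo-sum a y b x)) ⟩
    (A * X + B * Y) - (A * Y + B * X)                 ≈⟨ +-congˡ (⁻¹-∙-comm _ _) ⟨
    (A * X + B * Y) + (- (A * Y) + - (B * X))         ≈⟨ +-congˡ (+-comm _ _) ⟩
    (A * X + B * Y) + (- (B * X) + - (A * Y))         ≈⟨ interchange _ _ _ _ ⟩
    (A * X - B * X) + (B * Y - A * Y)
      ≈⟨ +-cong (+-congˡ (-‿distribˡ-* B X)) (+-cong (sym (-*-* B Y)) (-‿distribʳ-* A Y)) ⟩
    (A * X + - B * X) + (- B * - Y + A * - Y)
      ≈⟨ +-cong (distribʳ X A (- B)) (trans (distribʳ (- Y) A (- B)) (+-comm _ _)) ⟨
    (A - B) * X + (A - B) * - Y                       ≈⟨ distribˡ _ X (- Y) ⟨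
    (A - B) * (X - Y)                                 ≈⟨ *-cong (⟦⟧-difference a b) (⟦⟧-difference x y) ⟨
    ⟦ (a , b) ⟧ * ⟦ (x , y) ⟧                         ∎
    where
    A = a · 1#; B = b · 1#; X = x · 1#; Y = y · 1#
    ·-homo-sum : ∀ m n k l → (m ℕ.* n ℕ.+ k ℕ.* l) · 1# ≈ m · 1# * n · 1# + k · 1# * l · 1#
    ·-homo-sum m n k l = trans (×-homo-+ 1# (m ℕ.* n) (k ℕ.* l)) (+-cong (×1-homo-* m n) (×1-homo-* k l))
    -*-* : ∀ u v → - u * - v ≈ u * v
    -*-* u v = trans (sym (-‿distribˡ-* u (- v))) (trans (-‿cong (sym (-‿distribʳ-* u v))) (-‿involutive _))

  ⊖-homo : ∀ p → ⟦ ⊖ p ⟧ ≈ - ⟦ p ⟧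
  ⊖-homo (a , b) = begin
    ⟦ (b , a) ⟧                   ≈⟨ ⟦⟧-difference b a ⟩
    b · 1# - a · 1#               ≈⟨ +-congʳ (-‿involutive _) ⟨
    - - (b · 1#) + - (a · 1#)     ≈⟨ +-comm _ _ ⟩
    - (a · 1#) + - - (b · 1#)     ≈⟨ ⁻¹-∙-comm _ _ ⟩
    - (a · 1# - b · 1#)           ≈⟨ -‿cong (⟦⟧-difference a b) ⟨
    - ⟦ (a , b) ⟧                 ∎

  homomorphism : ℤ-rawRing -Raw-AlmostCommutative⟶ fromCommutativeRing R
  homomorphism = record
    { ⟦_⟧ = ⟦_⟧ ; +-homo = ⊕-homo ; *-homo = ⊗-homo ; -‿homo = ⊖-homo ; 0-homo = refl ; 1-homo = refl }

  canonical : ℤ → ℤ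
  canonical (suc a , suc b) = canonical (a , b)
  canonical p = p

  ⟦canonical⟧ : ∀ p → ⟦ canonical p ⟧ ≡.≡ ⟦ p ⟧
  ⟦canonical⟧ (suc a , suc b) = ⟦canonical⟧ (a , b)
  ⟦canonical⟧ (zero , b) = ≡.refl
  ⟦canonical⟧ (suc a , zero) = ≡.refl

  _≟_ : ∀ p q → Maybe (⟦ p ⟧ ≈ ⟦ q ⟧)
  p ≟ q with Product.≡-dec ℕ._≟_ ℕ._≟_ (canonical p) (canonical q)
  ... | yes eq =
    just (reflexive (≡.trans (≡.sym (⟦canonical⟧ p)) (≡.trans (≡.cong ⟦_⟧ eq) (⟦canonical⟧ q))))
  ... | no _ = nothing

  open import Algebra.Solver.Ring ℤ-rawRing (fromCommutativeRing R) homomorphism _≟_ public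
    using (Polynomial; con; _:+_; _:*_; :-_; _:-_; solve; _:=_)

  :0 :1 : ∀ {n} → Polynomial n
  :0 = con (0 , 0)
  :1 = con (1 , 0)

  Polynomial-rawRing : ℕ → RawRing 0ℓ 0ℓ
  Polynomial-rawRing n = record
    { Carrier = Polynomial n ; _≈_ = ≡._≡_ ; _+_ = _:+_ ; _*_ = _:*_ ; -_ = :-_
    ; 0# = :0 ; 1# = :1 }

-- Stated over a raw ring, so that the same definitions serve for ring
-- elements and for solver expressions.
module Matrix {a ℓ : Level} (R : RawRing a ℓ) where
  open RawRing R

  infixl 7 _·_ _⋆_
  infix 8 _ᵀ

  record Mat : Set a where
    constructor mat
    field m₁₁ m₁₂ m₂₁ m₂₂ : Carrier
  open Mat public

  _·_ : Mat → Mat → Mat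
  X · Y = mat (m₁₁ X * m₁₁ Y + m₁₂ X * m₂₁ Y) (m₁₁ X * m₁₂ Y + m₁₂ X * m₂₂ Y)
              (m₂₁ X * m₁₁ Y + m₂₂ X * m₂₁ Y) (m₂₁ X * m₁₂ Y + m₂₂ X * m₂₂ Y)

  I : Mat
  I = mat 1# 0# 0# 1#

  ⟨_⟩ : Carrier → Mat
  ⟨ x ⟩ = mat x 1# 1# 0#

  _ᵀ : Mat → Mat
  X ᵀ = mat (m₁₁ X) (m₂₁ X) (m₁₂ X) (m₂₂ X)

  _⋆_ : Carrier → Mat → Mat
  s ⋆ X = mat (s * m₁₁ X) (s * m₁₂ X) (s * m₂₁ X) (s * m₂₂ X)

  negateOffDiagonal : Mat → Mat
  negateOffDiagonal X = mat (m₁₁ X) (- m₁₂ X) (- m₂₁ X) (m₂₂ X)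

  det : Mat → Carrier
  det X = m₁₁ X * m₂₂ X + - (m₁₂ X * m₂₁ X)

-- A, A′, B, B′ stand for Aₙ, Aₙ₋₁, Bₙ, Bₙ₋₁ and s for (−1)ⁿ; W is then
-- the matrix of w, and glued Y N that of 1 w Y w′ when N is the matrix of w′.
module Gluing {a ℓ : Level} (R : RawRing a ℓ) (A A′ B B′ : RawRing.Carrier R) where
  open RawRing R
  open Matrix R public

  W : Mat
  W = mat B B′ (A + - B) (A′ + - B′)

  glued : Carrier → Mat → Mat
  glued Y N = ⟨ 1# ⟩ · (W · (⟨ Y ⟩ · N))

  negTail negRevTail : Carrier → Mat
  negTail s = s ⋆ negateOffDiagonal W
  negRevTail s = s ⋆ negateOffDiagonal (W ᵀ) · (⟨ - 1# ⟩ · I)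

  revTail : Mat
  revTail = W ᵀ · (⟨ 1# ⟩ · I)

  D-neg D-same : Carrier → Carrier
  D-neg Y = A * (B * (Y + 1#) + - A + B′)
  D-same Y = A * (B * (Y + - 1#) + A + B′)

  D-negRev D-rev : Carrier → Carrier → Carrier
  D-negRev Y s = s * Y * A * B + - 1#
  D-rev Y s = s * B * (Y * A + (1# + 1#) * A′) + - 1#

-- Each identity holds in the polynomial ring up to the displayed multiple
-- of the relation det W = s (resp. s det W = 1); the cofactors come from
-- dividing the difference of the two sides by that relation.
module GluingIdentities {c ℓ : Level} (R : CommutativeRing c ℓ) where
  open CommutativeRing R
  open import Algebra.Properties.Group +-group using (x≈y⇒x∙y⁻¹≈ε)
  open IntegerCoefficientSolver R
  open import Relation.Binary.Reasoning.Setoid setoid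

  x≈y⇒z+[x-y]*t≈z : ∀ {x y z t} → x ≈ y → z + (x - y) * t ≈ z
  x≈y⇒z+[x-y]*t≈z {x} {y} {z} {t} x≈y = begin
    z + (x - y) * t   ≈⟨ +-congˡ (*-congʳ (x≈y⇒x∙y⁻¹≈ε x≈y)) ⟩
    z + 0# * t        ≈⟨ +-congˡ (zeroˡ t) ⟩
    z + 0#            ≈⟨ +-identityʳ z ⟩
    z                 ∎

  glued-neg : ∀ A A′ B B′ Y s → let open Gluing rawRing A A′ B B′ in
    det W ≈ s → m₁₁ (glued Y (negTail s)) * (B * D-neg Y) ≈ m₂₁ (glued Y (negTail s)) * (A * (D-neg Y + s))
  glued-neg A A′ B B′ Y s det≈s = trans
    (solve 6 (λ A A′ B B′ Y s → let open Gluing (Polynomial-rawRing 6) A A′ B B′ in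
       m₁₁ (glued Y (negTail s)) :* (B :* D-neg Y)
         := m₂₁ (glued Y (negTail s)) :* (A :* (D-neg Y :+ s)) :+ (det W :- s) :* (s :* B :* D-neg Y))
       refl A A′ B B′ Y s)
    (x≈y⇒z+[x-y]*t≈z det≈s)

  glued-negRev : ∀ A A′ B B′ Y s → let open Gluing rawRing A A′ B B′ in
    s * det W ≈ 1# →
    m₁₁ (glued Y (negRevTail s)) * (B * D-negRev Y s) ≈ m₂₁ (glued Y (negRevTail s)) * (A * (D-negRev Y s + 1#))
  glued-negRev A A′ B B′ Y s s*det≈1 = trans
    (solve 6 (λ A A′ B B′ Y s → let open Gluing (Polynomial-rawRing 6) A A′ B B′ in
       m₁₁ (glued Y (negRevTail s)) :* (B :* D-negRev Y s)
         := m₂₁ (glued Y (negRevTail s)) :* (A :* (D-negRev Y s :+ :1))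
            :+ (s :* det W :- :1) :* (:- (s :* A :* A :* B :* Y)))
       refl A A′ B B′ Y s)
    (x≈y⇒z+[x-y]*t≈z s*det≈1)

  glued-rev : ∀ A A′ B B′ Y s → let open Gluing rawRing A A′ B B′ in
    s * det W ≈ 1# →
    m₁₁ (glued Y revTail) * (B * D-rev Y s) ≈ m₂₁ (glued Y revTail) * (A * (D-rev Y s + 1#))
  glued-rev A A′ B B′ Y s s*det≈1 = trans
    (solve 6 (λ A A′ B B′ Y s → let open Gluing (Polynomial-rawRing 6) A A′ B B′ in
       m₁₁ (glued Y revTail) :* (B :* D-rev Y s)
         := m₂₁ (glued Y revTail) :* (A :* (D-rev Y s :+ :1))
            :+ (s :* det W :- :1) :* (A :* B :* (Y :* A :+ (:1 :+ :1) :* A′)))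
       refl A A′ B B′ Y s)
    (x≈y⇒z+[x-y]*t≈z s*det≈1)

  glued-same : ∀ A A′ B B′ Y s → let open Gluing rawRing A A′ B B′ in
    det W ≈ s → m₁₁ (glued Y W) * (B * D-same Y) ≈ m₂₁ (glued Y W) * (A * (D-same Y + s))
  glued-same A A′ B B′ Y s det≈s = trans
    (solve 6 (λ A A′ B B′ Y s → let open Gluing (Polynomial-rawRing 6) A A′ B B′ in
       m₁₁ (glued Y W) :* (B :* D-same Y)
         := m₂₁ (glued Y W) :* (A :* (D-same Y :+ s)) :+ (det W :- s) :* (B :* D-same Y))
       refl A A′ B B′ Y s)
    (x≈y⇒z+[x-y]*t≈z det≈s)

module MatrixProperties {c ℓ : Level} (R : CommutativeRing c ℓ) where
  open CommutativeRing R
  open IntegerCoefficientSolver R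
  open Matrix rawRing
  private
    module P {n} = Matrix (Polynomial-rawRing n)

  infix 4 _≈ₘ_
  record _≈ₘ_ (X Y : Mat) : Set ℓ where
    constructor entrywise
    field
      ≈₁₁ : m₁₁ X ≈ m₁₁ Y
      ≈₁₂ : m₁₂ X ≈ m₁₂ Y
      ≈₂₁ : m₂₁ X ≈ m₂₁ Y
      ≈₂₂ : m₂₂ X ≈ m₂₂ Y
  open _≈ₘ_ public

  ≈ₘ-refl : ∀ {X} → X ≈ₘ X
  ≈ₘ-refl = entrywise refl refl refl refl

  ≈ₘ-sym : ∀ {X Y} → X ≈ₘ Y → Y ≈ₘ X
  ≈ₘ-sym (entrywise p q r u) = entrywise (sym p) (sym q) (sym r) (sym u)

  ≈ₘ-trans : ∀ {X Y Z} → X ≈ₘ Y → Y ≈ₘ Z → X ≈ₘ Z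
  ≈ₘ-trans (entrywise p q r u) (entrywise p′ q′ r′ u′) =
    entrywise (trans p p′) (trans q q′) (trans r r′) (trans u u′)

  ·-cong : ∀ {X X′ Y Y′} → X ≈ₘ X′ → Y ≈ₘ Y′ → X · Y ≈ₘ X′ · Y′
  ·-cong (entrywise p q r u) (entrywise p′ q′ r′ u′) = entrywise
    (+-cong (*-cong p p′) (*-cong q r′)) (+-cong (*-cong p q′) (*-cong q u′))
    (+-cong (*-cong r p′) (*-cong u r′)) (+-cong (*-cong r q′) (*-cong u u′))

  ᵀ-cong : ∀ {X X′} → X ≈ₘ X′ → X ᵀ ≈ₘ X′ ᵀ
  ᵀ-cong (entrywise p q r u) = entrywise p r q u

  ⋆-cong : ∀ {s s′ X X′} → s ≈ s′ → X ≈ₘ X′ → s ⋆ X ≈ₘ s′ ⋆ X′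
  ⋆-cong s≈s′ (entrywise p q r u) =
    entrywise (*-cong s≈s′ p) (*-cong s≈s′ q) (*-cong s≈s′ r) (*-cong s≈s′ u)

  negateOffDiagonal-cong : ∀ {X X′} → X ≈ₘ X′ → negateOffDiagonal X ≈ₘ negateOffDiagonal X′
  negateOffDiagonal-cong (entrywise p q r u) = entrywise p (-‿cong q) (-‿cong r) u

  det-cong : ∀ {X X′} → X ≈ₘ X′ → det X ≈ det X′
  det-cong (entrywise p q r u) = +-cong (*-cong p u) (-‿cong (*-cong q r))

  ·-assoc : ∀ X Y Z → (X · Y) · Z ≈ₘ X · (Y · Z)
  ·-assoc (mat a b c d) (mat e f g h) (mat i j k l) =
    entrywise (entry a b i k) (entry a b j l) (entry c d i k) (entry c d j l)
    where
    entry : ∀ x y z t → (x * e + y * g) * z + (x * f + y * h) * t ≈ x * (e * z + f * t) + y * (g * z + h * t)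
    entry = solve 8 (λ e f g h x y z t →
      (x :* e :+ y :* g) :* z :+ (x :* f :+ y :* h) :* t := x :* (e :* z :+ f :* t) :+ y :* (g :* z :+ h :* t))
      refl e f g h

  ·-identityˡ : ∀ X → I · X ≈ₘ X
  ·-identityˡ (mat a b c d) = entrywise (1x+0y a c) (1x+0y b d) (0x+1y a c) (0x+1y b d)
    where
    1x+0y : ∀ x y → 1# * x + 0# * y ≈ x
    0x+1y : ∀ x y → 0# * x + 1# * y ≈ y
    1x+0y = solve 2 (λ x y → :1 :* x :+ :0 :* y := x) refl
    0x+1y = solve 2 (λ x y → :0 :* x :+ :1 :* y := y) refl

  ·-identityʳ : ∀ X → X · I ≈ₘ X
  ·-identityʳ (mat a b c d) = entrywise (x1+y0 a b) (x0+y1 a b) (x1+y0 c d) (x0+y1 c d)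
    where
    x1+y0 : ∀ x y → x * 1# + y * 0# ≈ x
    x0+y1 : ∀ x y → x * 0# + y * 1# ≈ y
    x1+y0 = solve 2 (λ x y → x :* :1 :+ y :* :0 := x) refl
    x0+y1 = solve 2 (λ x y → x :* :0 :+ y :* :1 := y) refl

  ᵀ-anti-· : ∀ X Y → (X · Y) ᵀ ≈ₘ Y ᵀ · X ᵀ
  ᵀ-anti-· X Y = entrywise (swap _ _ _ _) (swap _ _ _ _) (swap _ _ _ _) (swap _ _ _ _)
    where
    swap : ∀ x y z t → x * y + z * t ≈ y * x + t * z
    swap x y z t = +-cong (*-comm x y) (*-comm z t)

  det-· : ∀ X Y → det (X · Y) ≈ det X * det Y
  det-· (mat a b c d) (mat e f g h) = solve 8 (λ a b c d e f g h →
    P.det (P.mat a b c d P.· P.mat e f g h) := P.det (P.mat a b c d) :* P.det (P.mat e f g h))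
    refl a b c d e f g h

  det-⟨⟩ : ∀ a → det ⟨ a ⟩ ≈ - 1#
  det-⟨⟩ = solve 1 (λ a → P.det P.⟨ a ⟩ := :- :1) refl

  ⟨-⟩-·-negateOffDiagonal : ∀ a s X →
    ⟨ - a ⟩ · (s ⋆ negateOffDiagonal X) ≈ₘ (- s) ⋆ negateOffDiagonal (⟨ a ⟩ · X)
  ⟨-⟩-·-negateOffDiagonal a s (mat p q r u) = entrywise
    (solve 6 (λ a s p q r u → P.m₁₁ (lhs a s p q r u) := P.m₁₁ (rhs a s p q r u)) refl a s p q r u)
    (solve 6 (λ a s p q r u → P.m₁₂ (lhs a s p q r u) := P.m₁₂ (rhs a s p q r u)) refl a s p q r u)
    (solve 6 (λ a s p q r u → P.m₂₁ (lhs a s p q r u) := P.m₂₁ (rhs a s p q r u)) refl a s p q r u)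
    (solve 6 (λ a s p q r u → P.m₂₂ (lhs a s p q r u) := P.m₂₂ (rhs a s p q r u)) refl a s p q r u)
    where
    lhs rhs : ∀ {n} (a s p q r u : Polynomial n) → P.Mat
    lhs a s p q r u = P.⟨ :- a ⟩ P.· (s P.⋆ P.negateOffDiagonal (P.mat p q r u))
    rhs a s p q r u = (:- s) P.⋆ P.negateOffDiagonal (P.⟨ a ⟩ P.· P.mat p q r u)

module ContinuedFractionMatrices {c ℓ : Level} (F : Field c ℓ) where
  open Field F
  open FieldDefs F
  open IntegerCoefficientSolver commutativeRing using (_:+_; _:*_; :-_; :0; :1; solve; _:=_)
  open Matrix rawRing
  open MatrixProperties commutativeRing
  open GluingIdentities commutativeRing
  open import Algebra.Properties.Ring ring using (-1*x≈-x)
  open import Relation.Binary.Reasoning.Setoid setoid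

  *-nonzero : ∀ {x y} → ¬ x ≈ 0# → ¬ y ≈ 0# → ¬ x * y ≈ 0#
  *-nonzero {x} {y} x≉0 y≉0 xy≈0 = y≉0 (begin
    y                     ≈⟨ *-identityˡ y ⟨
    1# * y                ≈⟨ *-congʳ (inv-law x x≉0) ⟨
    x * inv x x≉0 * y     ≈⟨ solve 3 (λ x i y → x :* i :* y := i :* (x :* y)) refl x (inv x x≉0) y ⟩
    inv x x≉0 * (x * y)   ≈⟨ *-congˡ xy≈0 ⟩
    inv x x≉0 * 0#        ≈⟨ zeroʳ _ ⟩
    0#                    ∎)

  *-cancelʳ-nonzero : ∀ {k x y} → ¬ k ≈ 0# → x * k ≈ y * k → x ≈ y
  *-cancelʳ-nonzero {k} {x} {y} k≉0 xk≈yk = begin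
    x                     ≈⟨ *-identityʳ x ⟨
    x * 1#                ≈⟨ *-congˡ (inv-law k k≉0) ⟨
    x * (k * inv k k≉0)   ≈⟨ *-assoc x k _ ⟨
    x * k * inv k k≉0     ≈⟨ *-congʳ xk≈yk ⟩
    y * k * inv k k≉0     ≈⟨ *-assoc y k _ ⟩
    y * (k * inv k k≉0)   ≈⟨ *-congˡ (inv-law k k≉0) ⟩
    y * 1#                ≈⟨ *-identityʳ y ⟩
    y                     ∎

  v*q≈p∧p*x≈q*y⇒v*x≈y : ∀ {v p q x y} → ¬ q ≈ 0# → v * q ≈ p → p * x ≈ q * y → v * x ≈ y
  v*q≈p∧p*x≈q*y⇒v*x≈y {v} {p} {q} {x} {y} q≉0 vq≈p px≈qy = *-cancelʳ-nonzero q≉0 (begin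
    v * x * q   ≈⟨ solve 3 (λ v x q → v :* x :* q := v :* q :* x) refl v x q ⟩
    v * q * x   ≈⟨ *-congʳ vq≈p ⟩
    p * x       ≈⟨ px≈qy ⟩
    q * y       ≈⟨ *-comm q y ⟩
    y * q       ∎)

  cross-multiply : ∀ {v A B D e} (B≉0 : ¬ B ≈ 0#) (D≉0 : ¬ D ≈ 0#) →
    v * (B * D) ≈ A * (D + e) → v ≈ A * inv B B≉0 * (1# + e * inv D D≉0)
  cross-multiply {v} {A} {B} {D} {e} B≉0 D≉0 v[BD]≈A[D+e] = sym (begin
    A * b * (1# + e * d)      ≈⟨ *-congˡ (+-congʳ (inv-law D D≉0)) ⟨
    A * b * (D * d + e * d)   ≈⟨ solve 5 (λ A b D d e → A :* b :* (D :* d :+ e :* d) := A :* (D :+ e) :* b :* d)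
                                   refl A b D d e ⟩
    A * (D + e) * b * d       ≈⟨ *-congʳ (*-congʳ v[BD]≈A[D+e]) ⟨
    v * (B * D) * b * d       ≈⟨ solve 5 (λ v B D b d → v :* (B :* D) :* b :* d := v :* (B :* b) :* (D :* d))
                                   refl v B D b d ⟩
    v * (B * b) * (D * d)     ≈⟨ *-cong (*-congˡ (inv-law B B≉0)) (inv-law D D≉0) ⟩
    v * 1# * 1#               ≈⟨ trans (*-identityʳ _) (*-identityʳ v) ⟩
    v                         ∎)
    where
    b = inv B B≉0
    d = inv D D≉0

  sgn-squared : ∀ n → sgn n * sgn n ≈ 1#
  sgn-squared zero = *-identityˡ 1#
  sgn-squared (suc n) = trans (solve 1 (λ s → :- s :* :- s := s :* s) refl (sgn n)) (sgn-squared n)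

  M : List Carrier → Mat
  M [] = I
  M (a ∷ w) = ⟨ a ⟩ · M w

  M-++ : ∀ u w → M (u ++ w) ≈ₘ M u · M w
  M-++ [] w = ≈ₘ-sym (·-identityˡ (M w))
  M-++ (a ∷ u) w = ≈ₘ-trans (·-cong ≈ₘ-refl (M-++ u w)) (≈ₘ-sym (·-assoc ⟨ a ⟩ (M u) (M w)))

  M-reverse : ∀ w → M (reverse w) ≈ₘ M w ᵀ
  M-reverse [] = ≈ₘ-refl
  M-reverse (a ∷ w) rewrite unfold-reverse a w =
    ≈ₘ-trans (M-++ (reverse w) [ a ])
      (≈ₘ-trans (·-cong (M-reverse w) (·-identityʳ ⟨ a ⟩)) (≈ₘ-sym (ᵀ-anti-· ⟨ a ⟩ (M w))))

  M-neg : ∀ w → M (neg w) ≈ₘ sgn (length w) ⋆ negateOffDiagonal (M w)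
  M-neg [] = entrywise (sym (*-identityˡ 1#)) 0≈1*-0 0≈1*-0 (sym (*-identityˡ 1#))
    where
    0≈1*-0 : 0# ≈ 1# * - 0#
    0≈1*-0 = solve 0 (:0 := :1 :* :- :0) refl
  M-neg (a ∷ w) = ≈ₘ-trans (·-cong ≈ₘ-refl (M-neg w)) (⟨-⟩-·-negateOffDiagonal a (sgn (length w)) (M w))

  det-M : ∀ w → det (M w) ≈ sgn (length w)
  det-M [] = solve 0 (:1 :* :1 :+ :- (:0 :* :0) := :1) refl
  det-M (a ∷ w) = begin
    det (⟨ a ⟩ · M w)          ≈⟨ det-· ⟨ a ⟩ (M w) ⟩
    det ⟨ a ⟩ * det (M w)      ≈⟨ *-cong (det-⟨⟩ a) (det-M w) ⟩
    - 1# * sgn (length w)      ≈⟨ -1*x≈-x _ ⟩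
    - sgn (length w)           ∎

  foldl-step : ∀ w x y →
    proj₁ (foldl step (x , y) w) ≈ x * m₁₁ (M w) + y * m₂₁ (M w) ×
    proj₂ (foldl step (x , y) w) ≈ x * m₁₂ (M w) + y * m₂₂ (M w)
  foldl-step [] x y = solve 2 (λ x y → x := x :* :1 :+ y :* :0) refl x y
                    , solve 2 (λ x y → y := x :* :0 :+ y :* :1) refl x y
  foldl-step (a ∷ w) x y with foldl-step w (a * x + y) x
  ... | first , second =
    trans first (entry (m₁₁ (M w)) (m₂₁ (M w))) , trans second (entry (m₁₂ (M w)) (m₂₂ (M w)))
    where
    entry : ∀ p r → (a * x + y) * p + x * r ≈ x * (a * p + 1# * r) + y * (1# * p + 0# * r)
    entry = solve 5 (λ a x y p r →
      (a :* x :+ y) :* p :+ x :* r := x :* (a :* p :+ :1 :* r) :+ y :* (:1 :* p :+ :0 :* r))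
      refl a x y

  CF-ratio : ∀ {L v} → CF L v → v * m₂₁ (M L) ≈ m₁₁ (M L) × ¬ m₂₁ (M L) ≈ 0#
  CF-ratio (cf-last b) =
      solve 1 (λ b → b :* (:1 :* :1 :+ :0 :* :0) := b :* :1 :+ :1 :* :0) refl b
    , λ m₂₁≈0 → 0≉1 (sym (trans (solve 0 (:1 := :1 :* :1 :+ :0 :* :0) refl) m₂₁≈0))
  CF-ratio (cf-cons b bs t cf t≉0) with CF-ratio cf
  ... | ty≈x , y≉0 = (begin
      (b + i) * (1# * x + 0# * y)  ≈⟨ solve 4 (λ b i x y → (b :+ i) :* (:1 :* x :+ :0 :* y) := b :* x :+ i :* x)
                                        refl b i x y ⟩
      b * x + i * x                ≈⟨ +-congˡ (*-congˡ ty≈x) ⟨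
      b * x + i * (t * y)          ≈⟨ solve 5 (λ b i x y t → b :* x :+ i :* (t :* y) := b :* x :+ t :* i :* y)
                                        refl b i x y t ⟩
      b * x + t * i * y            ≈⟨ +-congˡ (*-congʳ (inv-law t t≉0)) ⟩
      b * x + 1# * y               ∎)
    , λ m₂₁≈0 → *-nonzero t≉0 y≉0
        (trans ty≈x (trans (solve 2 (λ x y → x := :1 :* x :+ :0 :* y) refl x y) m₂₁≈0))
    where
    i = inv t t≉0
    x = m₁₁ (M bs)
    y = m₂₁ (M bs)

  module _ (w : List Carrier) where
    private
      A = Aₙ w
      A′ = Aₙ₋₁ w
      B = Bₙ w
      B′ = Bₙ₋₁ w
      s = sgn (length w)
    open Gluing rawRing A A′ B B′ using (W; glued; negTail; negRevTail; revTail)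

    M-convergents : M w ≈ₘ W
    M-convergents with foldl-step w 1# 1# | foldl-step w 1# 0#
    ... | A≈ , A′≈ | B≈ , B′≈ = entrywise
      (trans (1p+0r (m₁₁ (M w)) (m₂₁ (M w))) (sym B≈))
      (trans (1p+0r (m₁₂ (M w)) (m₂₂ (M w))) (sym B′≈))
      (trans (difference (m₁₁ (M w)) (m₂₁ (M w))) (sym (+-cong A≈ (-‿cong B≈))))
      (trans (difference (m₁₂ (M w)) (m₂₂ (M w))) (sym (+-cong A′≈ (-‿cong B′≈))))
      where
      1p+0r : ∀ p r → p ≈ 1# * p + 0# * r
      1p+0r = solve 2 (λ p r → p := :1 :* p :+ :0 :* r) refl
      difference : ∀ p r → r ≈ (1# * p + 1# * r) - (1# * p + 0# * r)
      difference = solve 2 (λ p r → r := (:1 :* p :+ :1 :* r) :+ :- (:1 :* p :+ :0 :* r)) refl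

    det-W : det W ≈ s
    det-W = trans (det-cong (≈ₘ-sym M-convergents)) (det-M w)

    s*det-W≈1 : s * det W ≈ 1#
    s*det-W≈1 = trans (*-congˡ det-W) (sgn-squared (length w))

    M-negTail : M (neg w) ≈ₘ negTail s
    M-negTail = ≈ₘ-trans (M-neg w) (⋆-cong refl (negateOffDiagonal-cong M-convergents))

    M-reverse-convergents : M (reverse w) ≈ₘ W ᵀ
    M-reverse-convergents = ≈ₘ-trans (M-reverse w) (ᵀ-cong M-convergents)

    M-negRevTail : M (neg (reverse w) ++ [ - 1# ]) ≈ₘ negRevTail s
    M-negRevTail = ≈ₘ-trans (M-++ (neg (reverse w)) [ - 1# ]) (·-cong M-neg-reverse ≈ₘ-refl)
      where
      M-neg-reverse : M (neg (reverse w)) ≈ₘ s ⋆ negateOffDiagonal (W ᵀ)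
      M-neg-reverse = ≈ₘ-trans (M-neg (reverse w))
        (⋆-cong (reflexive (≡.cong sgn (length-reverse w))) (negateOffDiagonal-cong M-reverse-convergents))

    M-revTail : M (reverse w ++ [ 1# ]) ≈ₘ revTail
    M-revTail = ≈ₘ-trans (M-++ (reverse w) [ 1# ]) (·-cong M-reverse-convergents ≈ₘ-refl)

    extension-value : ∀ Y R N D e → M R ≈ₘ N →
      m₁₁ (glued Y N) * (B * D) ≈ m₂₁ (glued Y N) * (A * (D + e)) →
      ∀ v → CF (1# ∷ (w ++ (Y ∷ R))) v → (B≉0 : ¬ B ≈ 0#) (D≉0 : ¬ D ≈ 0#) →
      v ≈ A * inv B B≉0 * (1# + e * inv D D≉0)
    extension-value Y R N D e R≈N identity v cf B≉0 D≉0 with CF-ratio cf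
    ... | vq≈p , q≉0 = cross-multiply B≉0 D≉0 (v*q≈p∧p*x≈q*y⇒v*x≈y
      (λ q≈0 → q≉0 (trans (≈₂₁ M≈glued) q≈0))
      (trans (*-congˡ (sym (≈₂₁ M≈glued))) (trans vq≈p (≈₁₁ M≈glued)))
      identity)
      where
      M≈glued : M (1# ∷ (w ++ (Y ∷ R))) ≈ₘ glued Y N
      M≈glued = ·-cong ≈ₘ-refl (≈ₘ-trans (M-++ w (Y ∷ R)) (·-cong M-convergents (·-cong ≈ₘ-refl R≈N)))

    extension-value-unit : ∀ Y R N D → M R ≈ₘ N →
      m₁₁ (glued Y N) * (B * D) ≈ m₂₁ (glued Y N) * (A * (D + 1#)) →
      ∀ v → CF (1# ∷ (w ++ (Y ∷ R))) v → (B≉0 : ¬ B ≈ 0#) (D≉0 : ¬ D ≈ 0#) →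
      v ≈ A * inv B B≉0 * (1# + inv D D≉0)
    extension-value-unit Y R N D R≈N identity v cf B≉0 D≉0 =
      trans (extension-value Y R N D 1# R≈N identity v cf B≉0 D≉0) (*-congˡ (+-congˡ (*-identityˡ _)))

lemma2p2 : ∀ {c ℓ : Level} (F : Field c ℓ) →
  let open Field F
      open FieldDefs F
  in (w : List Carrier) (Y : Carrier) →
     let n = length w
         A = Aₙ w
         A' = Aₙ₋₁ w
         B = Bₙ w
         B' = Bₙ₋₁ w
     in ((v : Carrier) → CF (1# ∷ (w ++ (Y ∷ neg w))) v →
         (pB : ¬ (B ≈ 0#)) →
         (pD : ¬ (A * (B * (Y + 1#) - A + B') ≈ 0#)) →
         v ≈ A * inv B pB * (1# + sgn n * inv (A * (B * (Y + 1#) - A + B')) pD))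
      × ((v : Carrier) → CF (1# ∷ (w ++ (Y ∷ (neg (reverse w) ++ (- 1# ∷ []))))) v →
         (pB : ¬ (B ≈ 0#)) →
         (pD : ¬ (sgn n * Y * A * B - 1# ≈ 0#)) →
         v ≈ A * inv B pB * (1# + inv (sgn n * Y * A * B - 1#) pD))
      × ((v : Carrier) → CF (1# ∷ (w ++ (Y ∷ (reverse w ++ (1# ∷ []))))) v →
         (pB : ¬ (B ≈ 0#)) →
         (pD : ¬ (sgn n * B * (Y * A + (1# + 1#) * A') - 1# ≈ 0#)) →
         v ≈ A * inv B pB * (1# + inv (sgn n * B * (Y * A + (1# + 1#) * A') - 1#) pD))
      × ((v : Carrier) → CF (1# ∷ (w ++ (Y ∷ w))) v →
         (pB : ¬ (B ≈ 0#)) →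
         (pD : ¬ (A * (B * (Y - 1#) + A + B') ≈ 0#)) →
         v ≈ A * inv B pB * (1# + sgn n * inv (A * (B * (Y - 1#) + A + B')) pD))
lemma2p2 F w Y =
    extension-value w Y (neg w) (negTail s) (D-neg Y) s
      (M-negTail w) (glued-neg A A′ B B′ Y s (det-W w))
  , extension-value-unit w Y (neg (reverse w) ++ [ - 1# ]) (negRevTail s) (D-negRev Y s)
      (M-negRevTail w) (glued-negRev A A′ B B′ Y s (s*det-W≈1 w))
  , extension-value-unit w Y (reverse w ++ [ 1# ]) revTail (D-rev Y s)
      (M-revTail w) (glued-rev A A′ B B′ Y s (s*det-W≈1 w))
  , extension-value w Y w W (D-same Y) s
      (M-convergents w) (glued-same A A′ B B′ Y s (det-W w))
  where
  open Field F
  open FieldDefs F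
  open ContinuedFractionMatrices F
  open GluingIdentities commutativeRing
  A = Aₙ w
  A′ = Aₙ₋₁ w
  B = Bₙ w
  B′ = Bₙ₋₁ w
  s = sgn (length w)
  open Gluing rawRing A A′ B B′ using (W; negTail; negRevTail; revTail; D-neg; D-negRev; D-rev; D-same)
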